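{- For an integer $h\geq 1$ let $\Gamma_{3^h}$ denote the multiplicative circulant graph $MC(3^h)$. For every integer $h\geq 2$, $diam(\Gamma_{3^h})=diam(\Gamma_{3^{h-1}})+1$.
   Context: For integers $m>1$, $h>0$, $MC(m^h)$ is the graph with vertex set $\mathbb{Z}_{m^h}$ in which distinct vertices $x,y$ are adjacent iff $x-y\equiv \pm m^i \pmod{m^h}$ for some $i\in\{0,\ldots,h-1\}$. $diam(\Gamma)$ is the maximum distance (shortest path length) between any pair of vertices of $\Gamma$. -}

module Defs where

open import Data.Nat using (ℕ; zero; suc; _+_; _*_; _^_; _<_; _≤_)
open import Data.Product using (Σ; ∃; _×_; _,_)
open import Data.Sum using (_⊎_)
open import Relation.Binary.PropositionalEquality using (_≡_)
open import Relation.Nullary using (¬_)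

-- The multiplicative circulant graph MC(m^h) on vertex set ℤ_{m^h},
-- vertices represented by naturals x < m^h.
-- Adjacency: x ≠ y and x - y ≡ ± m^i (mod m^h) for some i ∈ {0,…,h-1},
-- i.e. y ≡ x + m^i or x ≡ y + m^i (mod m^h), congruence written as
-- a + m^i = b + q·m^h for some q ∈ ℕ (valid since a,b < m^h).
Adj : (m h : ℕ) → ℕ → ℕ → Set
Adj m h x y =
  ¬ (x ≡ y) ×
  (Σ ℕ λ i → i < h ×
     ((∃ λ q → x + m ^ i ≡ y + q * m ^ h) ⊎ (∃ λ q → y + m ^ i ≡ x + q * m ^ h)))

data Walk (m h : ℕ) : ℕ → ℕ → ℕ → Set where
  here : ∀ {x} → Walk m h zero x x
  step : ∀ {k x y z} → Adj m h x y → y < m ^ h → Walk m h k y z →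
         Walk m h (suc k) x z

IsDist : (m h : ℕ) → ℕ → ℕ → ℕ → Set
IsDist m h x y d = Walk m h d x y × (∀ k → k < d → ¬ Walk m h k x y)

IsDiam : (m h : ℕ) → ℕ → Set
IsDiam m h D =
  (∀ x y → x < m ^ h → y < m ^ h → ∃ λ d → IsDist m h x y d × d ≤ D) ×
  (∃ λ x → ∃ λ y → x < m ^ h × y < m ^ h × IsDist m h x y D)

-- Write the residue of y − x modulo 3^h in balanced ternary with h digits in {−1, 0, 1},
-- discarding the final carry. Adding its nonzero digits ±3^i one at a time gives a walk
-- from x to y, so d(x, y) is at most the number of those digits, its weight. Conversely
-- the weight is 3^h-periodic and changes by at most one when ±3^i is added, so no walk is
-- shorter. The weight never exceeds h and equals h at 1 + 3 + ⋯ + 3^(h−1); hence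
-- diam MC(3^h) = h for every h, which is the claimed recursion.

module Submission where

open import Defs
open import Data.Nat
  using (ℕ; zero; suc; _+_; _*_; _^_; _<_; _≤_; _∸_; z≤n; s≤s; z<s; NonZero; >-nonZero)
open import Data.Nat.DivMod using (_%_; _/_; m%n<n; m≡m%n+[m/n]*n)
open import Data.Nat.Properties
open import Data.Product using (∃; _×_; _,_; proj₁; proj₂)
open import Data.Sum using (_⊎_; inj₁; inj₂)
open import Data.Empty using (⊥-elim)
open import Data.List using (List; []; _∷_; length; map)
open import Data.List.Properties using (length-map)
open import Data.List.Relation.Unary.All as All using (All; []; _∷_)
open import Data.List.Relation.Unary.All.Properties using (map⁺)
open import Level using (0ℓ)
open import Relation.Binary using (IsEquivalence; Setoid; tri<; tri≈; tri>)
open import Relation.Binary.PropositionalEquality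
open import Relation.Nullary using (¬_)
open import Algebra.Properties.CommutativeSemigroup +-commutativeSemigroup
  using (interchange; xy∙z≈xz∙y; x∙yz≈xz∙y; x∙yz≈y∙xz)
import Algebra.Properties.CommutativeSemigroup *-commutativeSemigroup as *-Props

infix 4 _≡_mod_

record _≡_mod_ (a b N : ℕ) : Set where
  constructor mkMod
  field
    k₁ k₂ : ℕ
    shifted : a + k₁ * N ≡ b + k₂ * N

≡mod-reflexive : ∀ {a b N} → a ≡ b → a ≡ b mod N
≡mod-reflexive refl = mkMod 0 0 refl

≡mod-sym : ∀ {a b N} → a ≡ b mod N → b ≡ a mod N
≡mod-sym (mkMod u v e) = mkMod v u (sym e)

+-cong-mod : ∀ {a b c d N} → a ≡ b mod N → c ≡ d mod N → a + c ≡ b + d mod N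
+-cong-mod {a} {b} {c} {d} {N} (mkMod u v e) (mkMod u′ v′ e′) = mkMod (u + u′) (v + v′) (begin
  a + c + (u + u′) * N       ≡⟨ cong (a + c +_) (*-distribʳ-+ N u u′) ⟩
  a + c + (u * N + u′ * N)   ≡⟨ interchange a c (u * N) (u′ * N) ⟩
  a + u * N + (c + u′ * N)   ≡⟨ cong₂ _+_ e e′ ⟩
  b + v * N + (d + v′ * N)   ≡⟨ interchange b (v * N) d (v′ * N) ⟩
  b + d + (v * N + v′ * N)   ≡⟨ cong (b + d +_) (*-distribʳ-+ N v v′) ⟨
  b + d + (v + v′) * N       ∎)
  where open ≡-Reasoning

+-cancelˡ-mod : ∀ {a b c N} → a + b ≡ a + c mod N → b ≡ c mod N
+-cancelˡ-mod {a} (mkMod u v e) =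
  mkMod u v (+-cancelˡ-≡ a _ _ (trans (sym (+-assoc a _ _)) (trans e (+-assoc a _ _))))

+-cancelʳ-mod : ∀ {a b c N} → a + c ≡ b + c mod N → a ≡ b mod N
+-cancelʳ-mod {a} {b} {c} {N} p =
  +-cancelˡ-mod (subst₂ (λ a b → a ≡ b mod N) (+-comm a c) (+-comm b c) p)

≡mod-trans : ∀ {a b c N} → a ≡ b mod N → b ≡ c mod N → a ≡ c mod N
≡mod-trans {a} {b} {c} {N} p q =
  +-cancelˡ-mod (subst (λ z → z ≡ b + c mod N) (+-comm a b) (+-cong-mod p q))

≡mod-isEquivalence : ∀ N → IsEquivalence (λ a b → a ≡ b mod N)
≡mod-isEquivalence N = record
  { refl = ≡mod-reflexive refl ; sym = ≡mod-sym ; trans = ≡mod-trans }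

≡mod-setoid : ℕ → Setoid 0ℓ 0ℓ
≡mod-setoid N = record { isEquivalence = ≡mod-isEquivalence N }

module ≡mod-Reasoning (N : ℕ) where
  open import Relation.Binary.Reasoning.Setoid (≡mod-setoid N) public

*-cong-mod : ∀ k {a b N} → a ≡ b mod N → k * a ≡ k * b mod k * N
*-cong-mod k {a} {b} {N} (mkMod u v e) = mkMod u v (begin
  k * a + u * (k * N)   ≡⟨ cong (k * a +_) (*-Props.x∙yz≈y∙xz u k N) ⟩
  k * a + k * (u * N)   ≡⟨ *-distribˡ-+ k a (u * N) ⟨
  k * (a + u * N)       ≡⟨ cong (k *_) e ⟩
  k * (b + v * N)       ≡⟨ *-distribˡ-+ k b (v * N) ⟩
  k * b + k * (v * N)   ≡⟨ cong (k * b +_) (*-Props.x∙yz≈y∙xz v k N) ⟨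
  k * b + v * (k * N)   ∎)
  where open ≡-Reasoning

+-multiple⇒≡mod : ∀ {a b} q N → a ≡ b + q * N → a ≡ b mod N
+-multiple⇒≡mod {a} q N e = mkMod 0 q (trans (+-identityʳ a) e)

+-modulus : ∀ a N → a + N ≡ a mod N
+-modulus a N = +-multiple⇒≡mod 1 N (cong (a +_) (sym (+-identityʳ N)))

≡mod-one : ∀ a b → a ≡ b mod 1
≡mod-one a b = mkMod b a (begin
  a + b * 1   ≡⟨ cong (a +_) (*-identityʳ b) ⟩
  a + b       ≡⟨ +-comm a b ⟩
  b + a       ≡⟨ cong (b +_) (*-identityʳ a) ⟨
  b + a * 1   ∎)
  where open ≡-Reasoning

≡mod⇒+multiple : ∀ {a y N} → a ≡ y mod N → y < N → ∃ λ q → a ≡ y + q * N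
≡mod⇒+multiple (mkMod u v e) y<N = from-multiples u v e y<N
  where
  from-multiples : ∀ {a y N} u v → a + u * N ≡ y + v * N → y < N → ∃ λ q → a ≡ y + q * N
  from-multiples {a} zero v e _ = v , trans (sym (+-identityʳ a)) e
  from-multiples {a} {y} {N} (suc u) zero e y<N = ⊥-elim (<⇒≱ y<N (begin
    N                 ≤⟨ m≤m+n N (u * N) ⟩
    N + u * N         ≤⟨ m≤n+m (N + u * N) a ⟩
    a + (N + u * N)   ≡⟨ e ⟩
    y + 0             ≡⟨ +-identityʳ y ⟩
    y                 ∎))
    where open ≤-Reasoning
  from-multiples {a} {y} {N} (suc u) (suc v) e y<N =
    from-multiples u v (+-cancelʳ-≡ N _ _ (trans (N-to-end a u) (trans e (sym (N-to-end y v))))) y<N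
    where
    N-to-end : ∀ z w → z + w * N + N ≡ z + (N + w * N)
    N-to-end z w = trans (+-assoc z (w * N) N) (cong (z +_) (+-comm (w * N) N))

≡mod⇒≡ : ∀ {a b N} → a ≡ b mod N → a < N → b < N → a ≡ b
≡mod⇒≡ {a} {b} {N} p a<N b<N with ≡mod⇒+multiple p b<N
... | zero , e = trans e (+-identityʳ b)
... | suc q , e = ⊥-elim (<⇒≱ a<N (begin
  N                   ≤⟨ m≤m+n N (q * N) ⟩
  N + q * N           ≤⟨ m≤n+m (N + q * N) b ⟩
  b + (N + q * N)     ≡⟨ e ⟨
  a                   ∎))
  where open ≤-Reasoning

≡mod-residue : ∀ a N .{{_ : NonZero N}} → ∃ λ y → y < N × y ≡ a mod N
≡mod-residue a N =
  a % N , m%n<n a N , ≡mod-sym (+-multiple⇒≡mod (a / N) N (m≡m%n+[m/n]*n a N))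

+-nonzeroResidue : ∀ {x d N} → 0 < d → d < N → ¬ (x + d ≡ x mod N)
+-nonzeroResidue {x} {d} {N} 0<d d<N p = <⇒≢ 0<d (sym (≡mod⇒≡ d≡0 d<N (≤-<-trans z≤n d<N)))
  where
  d≡0 : d ≡ 0 mod N
  d≡0 = +-cancelˡ-mod (subst (λ z → x + d ≡ z mod N) (sym (+-identityʳ x)) p)

+-≡mod-compose : ∀ {x y₁ y a₁ b₁ a b N} →
                 y₁ + a₁ ≡ x + b₁ mod N → y + a ≡ y₁ + b mod N →
                 y + (a₁ + a) ≡ x + (b₁ + b) mod N
+-≡mod-compose {x} {y₁} {y} {a₁} {b₁} {a} {b} {N} p q = begin
  y + (a₁ + a)     ≡⟨ x∙yz≈xz∙y y a₁ a ⟩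
  y + a + a₁       ≈⟨ +-cong-mod q (≡mod-reflexive refl) ⟩
  y₁ + b + a₁      ≡⟨ xy∙z≈xz∙y y₁ b a₁ ⟩
  y₁ + a₁ + b      ≈⟨ +-cong-mod p (≡mod-reflexive refl) ⟩
  x + b₁ + b       ≡⟨ +-assoc x b₁ b ⟩
  x + (b₁ + b)     ∎
  where open ≡mod-Reasoning N

data Sign : Set where
  plus minus : Sign

SignedPower : Set
SignedPower = Sign × ℕ

exponent : SignedPower → ℕ
exponent = proj₂

shift : SignedPower → SignedPower
shift (s , i) = s , suc i

value⁺ value⁻ : ℕ → SignedPower → ℕ
value⁺ m (plus , i) = m ^ i
value⁺ m (minus , i) = 0
value⁻ m (plus , i) = 0
value⁻ m (minus , i) = m ^ i

value⁺-shift : ∀ m s → value⁺ m (shift s) ≡ m * value⁺ m s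
value⁺-shift m (plus , i) = refl
value⁺-shift m (minus , i) = sym (*-zeroʳ m)

value⁻-shift : ∀ m s → value⁻ m (shift s) ≡ m * value⁻ m s
value⁻-shift m (plus , i) = sym (*-zeroʳ m)
value⁻-shift m (minus , i) = refl

sumOf : (SignedPower → ℕ) → List SignedPower → ℕ
sumOf f [] = 0
sumOf f (s ∷ L) = f s + sumOf f L

sumOf-shift : ∀ m f → (∀ s → f (shift s) ≡ m * f s) →
              ∀ L → sumOf f (map shift L) ≡ m * sumOf f L
sumOf-shift m f f-shift [] = sym (*-zeroʳ m)
sumOf-shift m f f-shift (s ∷ L) = begin
  f (shift s) + sumOf f (map shift L)   ≡⟨ cong₂ _+_ (f-shift s) (sumOf-shift m f f-shift L) ⟩
  m * f s + m * sumOf f L               ≡⟨ *-distribˡ-+ m (f s) (sumOf f L) ⟨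
  m * (f s + sumOf f L)                 ∎
  where open ≡-Reasoning

sum⁺ sum⁻ : ℕ → List SignedPower → ℕ
sum⁺ m = sumOf (value⁺ m)
sum⁻ m = sumOf (value⁻ m)

module _ {m : ℕ} (1<m : 1 < m) where

  private instance
    m≢0 : NonZero m
    m≢0 = >-nonZero (<-trans z<s 1<m)

  plusStep : ∀ {h i x} → i < h → x < m ^ h →
             ∃ λ y → y < m ^ h × Adj m h x y × y ≡ x + m ^ i mod m ^ h
  plusStep {h} {i} {x} i<h x<N with ≡mod-residue (x + m ^ i) (m ^ h) {{m^n≢0 m h}}
  ... | y , y<N , y≡ =
    y , y<N , (x≢y , i , i<h , inj₁ (≡mod⇒+multiple (≡mod-sym y≡) y<N)) , y≡
    where
    x≢y : ¬ x ≡ y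
    x≢y refl = +-nonzeroResidue (m^n>0 m i) (^-monoʳ-< m 1<m i<h) (≡mod-sym y≡)

  minusStep : ∀ {h i x} → i < h → x < m ^ h →
              ∃ λ y → y < m ^ h × Adj m h x y × y + m ^ i ≡ x mod m ^ h
  minusStep {h} {i} {x} i<h x<N with ≡mod-residue (x + (m ^ h ∸ m ^ i)) (m ^ h) {{m^n≢0 m h}}
  ... | y , y<N , y≡ =
    y , y<N , (x≢y , i , i<h , inj₂ (≡mod⇒+multiple y+mⁱ≡x x<N)) , y+mⁱ≡x
    where
    open ≡mod-Reasoning (m ^ h)
    y+mⁱ≡x : y + m ^ i ≡ x mod m ^ h
    y+mⁱ≡x = begin
      y + m ^ i                       ≈⟨ +-cong-mod y≡ (≡mod-reflexive refl) ⟩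
      x + (m ^ h ∸ m ^ i) + m ^ i     ≡⟨ +-assoc x (m ^ h ∸ m ^ i) (m ^ i) ⟩
      x + (m ^ h ∸ m ^ i + m ^ i)     ≡⟨ cong (x +_) (m∸n+n≡m (<⇒≤ (^-monoʳ-< m 1<m i<h))) ⟩
      x + m ^ h                       ≈⟨ +-modulus x (m ^ h) ⟩
      x                               ∎
    x≢y : ¬ x ≡ y
    x≢y refl = +-nonzeroResidue (m^n>0 m i) (^-monoʳ-< m 1<m i<h) y+mⁱ≡x

  signedPowerStep : ∀ {h x} s → exponent s < h → x < m ^ h →
                    ∃ λ y → y < m ^ h × Adj m h x y ×
                            y + value⁻ m s ≡ x + value⁺ m s mod m ^ h
  signedPowerStep (plus , i) i<h x<N =
    let y , y<N , x~y , y≡ = plusStep i<h x<N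
    in y , y<N , x~y , ≡mod-trans (≡mod-reflexive (+-identityʳ y)) y≡
  signedPowerStep {x = x} (minus , i) i<h x<N =
    let y , y<N , x~y , y≡ = minusStep i<h x<N
    in y , y<N , x~y , ≡mod-trans y≡ (≡mod-reflexive (sym (+-identityʳ x)))

  walkAlong : ∀ {h x} → x < m ^ h → (L : List SignedPower) → All (λ s → exponent s < h) L →
              ∃ λ y → y < m ^ h × Walk m h (length L) x y ×
                      y + sum⁻ m L ≡ x + sum⁺ m L mod m ^ h
  walkAlong {x = x} x<N [] [] = x , x<N , here , ≡mod-reflexive refl
  walkAlong {x = x} x<N (s ∷ L) (s<h ∷ L<h) =
    let y₁ , y₁<N , x~y₁ , y₁≡ = signedPowerStep s s<h x<N
        y , y<N , w , y≡ = walkAlong y₁<N L L<h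
    in y , y<N , step x~y₁ y₁<N w ,
       +-≡mod-compose {x} {y₁} {y} {value⁻ m s} {value⁺ m s} {sum⁻ m L} {sum⁺ m L} y₁≡ y≡

triple : ℕ → ℕ
triple zero = zero
triple (suc q) = suc (suc (suc (triple q)))

triple≡3* : ∀ q → triple q ≡ 3 * q
triple≡3* zero = refl
triple≡3* (suc q) = trans (cong (3 +_) (triple≡3* q)) (sym (*-suc 3 q))

triple-+ : ∀ q n → triple q + 3 * n ≡ triple (q + n)
triple-+ q n = begin
  triple q + 3 * n   ≡⟨ cong (_+ 3 * n) (triple≡3* q) ⟩
  3 * q + 3 * n      ≡⟨ *-distribˡ-+ 3 q n ⟨
  3 * (q + n)        ≡⟨ triple≡3* (q + n) ⟨
  triple (q + n)     ∎
  where open ≡-Reasoning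

data Base3 : ℕ → Set where
  rem0 : ∀ q → Base3 (triple q)
  rem1 : ∀ q → Base3 (suc (triple q))
  rem2 : ∀ q → Base3 (suc (suc (triple q)))

base3 : ∀ n → Base3 n
base3 zero = rem0 0
base3 (suc n) with base3 n
... | rem0 q = rem1 q
... | rem1 q = rem2 q
... | rem2 q = rem0 (suc q)

base3-triple : ∀ q → base3 (triple q) ≡ rem0 q
base3-triple zero = refl
base3-triple (suc q) rewrite base3-triple q = refl

base3-triple+1 : ∀ q → base3 (suc (triple q)) ≡ rem1 q
base3-triple+1 q rewrite base3-triple q = refl

base3-triple+2 : ∀ q → base3 (suc (suc (triple q))) ≡ rem2 q
base3-triple+2 q rewrite base3-triple+1 q = refl

-- A remainder 2 is written as 3 − 1, carrying 1 into the quotient.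
balancedTernary : ℕ → ℕ → List SignedPower
balancedTernary zero n = []
balancedTernary (suc h) n with base3 n
... | rem0 q = map shift (balancedTernary h q)
... | rem1 q = (plus , 0) ∷ map shift (balancedTernary h q)
... | rem2 q = (minus , 0) ∷ map shift (balancedTernary h (suc q))

weight : ℕ → ℕ → ℕ
weight h n = length (balancedTernary h n)

weight-triple : ∀ h q → weight (suc h) (triple q) ≡ weight h q
weight-triple h q rewrite base3-triple q = length-map shift (balancedTernary h q)

weight-triple+1 : ∀ h q → weight (suc h) (suc (triple q)) ≡ suc (weight h q)
weight-triple+1 h q rewrite base3-triple+1 q = cong suc (length-map shift (balancedTernary h q))

weight-triple+2 : ∀ h q → weight (suc h) (suc (suc (triple q))) ≡ suc (weight h (suc q))
weight-triple+2 h q rewrite base3-triple+2 q = cong suc (length-map shift (balancedTernary h (suc q)))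

Represents : ℕ → List SignedPower → ℕ → Set
Represents n L N = n + sum⁻ 3 L ≡ sum⁺ 3 L mod N

triple-represents : ∀ q L {N} → Represents q L N → Represents (triple q) (map shift L) (3 * N)
triple-represents q L {N} p = begin
  triple q + sum⁻ 3 (map shift L)   ≡⟨ cong₂ _+_ (triple≡3* q) (sum⁻-shift L) ⟩
  3 * q + 3 * sum⁻ 3 L              ≡⟨ *-distribˡ-+ 3 q (sum⁻ 3 L) ⟨
  3 * (q + sum⁻ 3 L)                ≈⟨ *-cong-mod 3 p ⟩
  3 * sum⁺ 3 L                      ≡⟨ sum⁺-shift L ⟨
  sum⁺ 3 (map shift L)              ∎
  where
  open ≡mod-Reasoning (3 * N)
  sum⁺-shift = sumOf-shift 3 (value⁺ 3) (value⁺-shift 3)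
  sum⁻-shift = sumOf-shift 3 (value⁻ 3) (value⁻-shift 3)

balancedTernary-represents : ∀ h n → Represents n (balancedTernary h n) (3 ^ h)
balancedTernary-represents zero n = ≡mod-one _ _
balancedTernary-represents (suc h) n with base3 n
... | rem0 q = triple-represents q (balancedTernary h q) (balancedTernary-represents h q)
... | rem1 q = +-cong-mod (≡mod-reflexive refl)
                 (triple-represents q (balancedTernary h q) (balancedTernary-represents h q))
... | rem2 q = ≡mod-trans (≡mod-reflexive (+-suc (suc (suc (triple q))) _))
                 (triple-represents (suc q) (balancedTernary h (suc q))
                                    (balancedTernary-represents h (suc q)))

All-exponent-shift : ∀ {h L} → All (λ s → exponent s < h) L →
                     All (λ s → exponent s < suc h) (map shift L)
All-exponent-shift ps = map⁺ (All.map s≤s ps)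

balancedTernary-exponents : ∀ h n → All (λ s → exponent s < h) (balancedTernary h n)
balancedTernary-exponents zero n = []
balancedTernary-exponents (suc h) n with base3 n
... | rem0 q = All-exponent-shift (balancedTernary-exponents h q)
... | rem1 q = z<s ∷ All-exponent-shift (balancedTernary-exponents h q)
... | rem2 q = z<s ∷ All-exponent-shift (balancedTernary-exponents h (suc q))

weight-≤ : ∀ h n → weight h n ≤ h
weight-≤ zero n = z≤n
weight-≤ (suc h) n = by-base3 (base3 n)
  where
  by-base3 : ∀ {n} → Base3 n → weight (suc h) n ≤ suc h
  by-base3 (rem0 q) rewrite weight-triple h q = m≤n⇒m≤1+n (weight-≤ h q)
  by-base3 (rem1 q) rewrite weight-triple+1 h q = s≤s (weight-≤ h q)
  by-base3 (rem2 q) rewrite weight-triple+2 h q = s≤s (weight-≤ h (suc q))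

WithinOne : ℕ → ℕ → Set
WithinOne a b = a ≤ suc b × b ≤ suc a

WithinOne-sym : ∀ {a b} → WithinOne a b → WithinOne b a
WithinOne-sym (p , q) = q , p

WithinOne-suc : ∀ {a b} → WithinOne a b → WithinOne (suc a) (suc b)
WithinOne-suc (p , q) = s≤s p , s≤s q

WithinOne-1+n : ∀ n → WithinOne (suc n) n
WithinOne-1+n n = ≤-refl , m≤n⇒m≤1+n (n≤1+n n)

weight-suc : ∀ h x → WithinOne (weight h (suc x)) (weight h x)
weight-suc zero x = z≤n , z≤n
weight-suc (suc h) x = by-base3 (base3 x)
  where
  by-base3 : ∀ {x} → Base3 x → WithinOne (weight (suc h) (suc x)) (weight (suc h) x)
  by-base3 (rem0 q) rewrite weight-triple+1 h q | weight-triple h q = WithinOne-1+n (weight h q)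
  by-base3 (rem1 q) rewrite weight-triple+2 h q | weight-triple+1 h q = WithinOne-suc (weight-suc h q)
  by-base3 (rem2 q) rewrite weight-triple h (suc q) | weight-triple+2 h q =
    WithinOne-sym (WithinOne-1+n (weight h (suc q)))

weight-+-pow : ∀ {h i} → i < h → ∀ x → WithinOne (weight h (x + 3 ^ i)) (weight h x)
weight-+-pow {suc h} {zero} _ x =
  subst (λ z → WithinOne (weight (suc h) z) (weight (suc h) x)) (+-comm 1 x) (weight-suc (suc h) x)
weight-+-pow {suc h} {suc i} (s≤s i<h) x = by-base3 (base3 x)
  where
  by-base3 : ∀ {x} → Base3 x → WithinOne (weight (suc h) (x + 3 ^ suc i)) (weight (suc h) x)
  by-base3 (rem0 q) rewrite triple-+ q (3 ^ i) | weight-triple h (q + 3 ^ i) | weight-triple h q =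
    weight-+-pow i<h q
  by-base3 (rem1 q) rewrite triple-+ q (3 ^ i) | weight-triple+1 h (q + 3 ^ i) | weight-triple+1 h q =
    WithinOne-suc (weight-+-pow i<h q)
  by-base3 (rem2 q) rewrite triple-+ q (3 ^ i) | weight-triple+2 h (q + 3 ^ i) | weight-triple+2 h q =
    WithinOne-suc (weight-+-pow i<h (suc q))

weight-+-multiple : ∀ h k x → weight h (x + k * 3 ^ h) ≡ weight h x
weight-+-multiple zero k x = refl
weight-+-multiple (suc h) k x = by-base3 (base3 x)
  where
  triple-+-multiple : ∀ q → triple q + k * (3 * 3 ^ h) ≡ triple (q + k * 3 ^ h)
  triple-+-multiple q =
    trans (cong (triple q +_) (*-Props.x∙yz≈y∙xz k 3 (3 ^ h))) (triple-+ q (k * 3 ^ h))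
  by-base3 : ∀ {x} → Base3 x → weight (suc h) (x + k * 3 ^ suc h) ≡ weight (suc h) x
  by-base3 (rem0 q) rewrite triple-+-multiple q | weight-triple h (q + k * 3 ^ h) | weight-triple h q =
    weight-+-multiple h k q
  by-base3 (rem1 q) rewrite triple-+-multiple q | weight-triple+1 h (q + k * 3 ^ h) | weight-triple+1 h q =
    cong suc (weight-+-multiple h k q)
  by-base3 (rem2 q) rewrite triple-+-multiple q | weight-triple+2 h (q + k * 3 ^ h) | weight-triple+2 h q =
    cong suc (weight-+-multiple h k (suc q))

weight-cong : ∀ h {a b} → a ≡ b mod 3 ^ h → weight h a ≡ weight h b
weight-cong h {a} {b} (mkMod u v e) = begin
  weight h a                 ≡⟨ weight-+-multiple h u a ⟨
  weight h (a + u * 3 ^ h)   ≡⟨ cong (weight h) e ⟩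
  weight h (b + v * 3 ^ h)   ≡⟨ weight-+-multiple h v b ⟩
  weight h b                 ∎
  where open ≡-Reasoning

weight-zero : ∀ h → weight h 0 ≡ 0
weight-zero zero = refl
weight-zero (suc h) = trans (weight-triple h 0) (weight-zero h)

weight-+-pow-mod : ∀ {h i a b} → i < h → a ≡ b + 3 ^ i mod 3 ^ h →
                   WithinOne (weight h a) (weight h b)
weight-+-pow-mod {h} {i} {a} {b} i<h a≡ =
  subst (λ w → WithinOne w (weight h b)) (sym (weight-cong h a≡)) (weight-+-pow i<h b)

weight-adj : ∀ {h x y} → Adj 3 h x y → ∀ c → WithinOne (weight h (y + c)) (weight h (x + c))
weight-adj {h} {x} {y} (_ , i , i<h , x~y) c = by-direction x~y
  where
  translate : ∀ {a b} q → a + 3 ^ i ≡ b + q * 3 ^ h → b + c ≡ a + c + 3 ^ i mod 3 ^ h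
  translate {a} {b} q e = ≡mod-trans
    (+-cong-mod (≡mod-sym (+-multiple⇒≡mod q (3 ^ h) e)) (≡mod-reflexive refl))
    (≡mod-reflexive (xy∙z≈xz∙y a (3 ^ i) c))
  by-direction : (∃ λ q → x + 3 ^ i ≡ y + q * 3 ^ h) ⊎ (∃ λ q → y + 3 ^ i ≡ x + q * 3 ^ h) →
                 WithinOne (weight h (y + c)) (weight h (x + c))
  by-direction (inj₁ (q , e)) = weight-+-pow-mod i<h (translate q e)
  by-direction (inj₂ (q , e)) = WithinOne-sym (weight-+-pow-mod i<h (translate q e))

weight-walk : ∀ {h k x y} → Walk 3 h k x y → ∀ c → weight h (y + c) ≤ k + weight h (x + c)
weight-walk here c = ≤-refl
weight-walk {h} {suc k} {x} {y} (step {y = y₁} x~y₁ _ w) c = begin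
  weight h (y + c)             ≤⟨ weight-walk w c ⟩
  k + weight h (y₁ + c)        ≤⟨ +-monoʳ-≤ k (proj₁ (weight-adj x~y₁ c)) ⟩
  k + suc (weight h (x + c))   ≡⟨ +-suc k _ ⟩
  suc k + weight h (x + c)     ∎
  where open ≤-Reasoning

walk-length-≥-weight : ∀ {h k x y} → x < 3 ^ h → Walk 3 h k x y →
                       weight h (y + (3 ^ h ∸ x)) ≤ k
walk-length-≥-weight {h} {k} {x} {y} x<N w = begin
  weight h (y + (3 ^ h ∸ x))        ≤⟨ weight-walk w (3 ^ h ∸ x) ⟩
  k + weight h (x + (3 ^ h ∸ x))    ≡⟨ cong (λ z → k + weight h z) (m+[n∸m]≡n (<⇒≤ x<N)) ⟩
  k + weight h (3 ^ h)              ≡⟨ cong (k +_) (weight-cong h (+-modulus 0 (3 ^ h))) ⟩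
  k + weight h 0                    ≡⟨ cong (k +_) (weight-zero h) ⟩
  k + 0                             ≡⟨ +-identityʳ k ⟩
  k                                 ∎
  where open ≤-Reasoning

walk-of-weight : ∀ {h x y} → x < 3 ^ h → y < 3 ^ h →
                 Walk 3 h (weight h (y + (3 ^ h ∸ x))) x y
walk-of-weight {h} {x} {y} x<N y<N =
  endsAt-y (walkAlong (s≤s (s≤s z≤n)) x<N L (balancedTernary-exponents h n))
  where
  N = 3 ^ h
  n = y + (N ∸ x)
  L = balancedTernary h n
  x+n≡y+N : x + n ≡ y + N
  x+n≡y+N = trans (x∙yz≈y∙xz x y (N ∸ x)) (cong (y +_) (m+[n∸m]≡n (<⇒≤ x<N)))
  y′≡y : ∀ {y′} → y′ + sum⁻ 3 L ≡ x + sum⁺ 3 L mod N → y′ ≡ y mod N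
  y′≡y {y′} y′≡ = +-cancelʳ-mod (begin
    y′ + sum⁻ 3 L          ≈⟨ y′≡ ⟩
    x + sum⁺ 3 L           ≈⟨ +-cong-mod (≡mod-reflexive refl)
                                   (≡mod-sym (balancedTernary-represents h n)) ⟩
    x + (n + sum⁻ 3 L)     ≡⟨ +-assoc x n (sum⁻ 3 L) ⟨
    x + n + sum⁻ 3 L       ≡⟨ cong (_+ sum⁻ 3 L) x+n≡y+N ⟩
    y + N + sum⁻ 3 L       ≈⟨ +-cong-mod (+-modulus y N) (≡mod-reflexive refl) ⟩
    y + sum⁻ 3 L           ∎)
    where open ≡mod-Reasoning N
  endsAt-y : (∃ λ y′ → y′ < N × Walk 3 h (length L) x y′ ×
                       y′ + sum⁻ 3 L ≡ x + sum⁺ 3 L mod N) →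
             Walk 3 h (length L) x y
  endsAt-y (y′ , y′<N , w , y′≡) =
    subst (Walk 3 h (length L) x) (≡mod⇒≡ (y′≡y y′≡) y′<N y<N) w

distance-weight : ∀ {h x y} → x < 3 ^ h → y < 3 ^ h →
                  IsDist 3 h x y (weight h (y + (3 ^ h ∸ x)))
distance-weight x<N y<N =
  walk-of-weight x<N y<N , λ k k<d w → <⇒≱ k<d (walk-length-≥-weight x<N w)

allOnes : ℕ → ℕ
allOnes zero = 0
allOnes (suc h) = suc (triple (allOnes h))

weight-allOnes : ∀ h → weight h (allOnes h) ≡ h
weight-allOnes zero = refl
weight-allOnes (suc h) = trans (weight-triple+1 h (allOnes h)) (cong suc (weight-allOnes h))

allOnes< : ∀ h → allOnes h < 3 ^ h
allOnes< zero = s≤s z≤n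
allOnes< (suc h) = begin-strict
  suc (triple (allOnes h))   <⟨ n≤1+n _ ⟩
  triple (suc (allOnes h))   ≡⟨ triple≡3* (suc (allOnes h)) ⟩
  3 * suc (allOnes h)        ≤⟨ *-monoʳ-≤ 3 (allOnes< h) ⟩
  3 * 3 ^ h                  ∎
  where open ≤-Reasoning

diameter-MC3 : ∀ h → IsDiam 3 h h
diameter-MC3 h =
  (λ x y x<N y<N → let n = y + (3 ^ h ∸ x) in weight h n , distance-weight x<N y<N , weight-≤ h n) ,
  0 , allOnes h , m^n>0 3 h , allOnes< h ,
  subst (IsDist 3 h 0 (allOnes h)) weight≡h
        (distance-weight {h} {0} {allOnes h} (m^n>0 3 h) (allOnes< h))
  where
  weight≡h : weight h (allOnes h + 3 ^ h) ≡ h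
  weight≡h = trans (weight-cong h (+-modulus (allOnes h) (3 ^ h))) (weight-allOnes h)

IsDist-unique : ∀ {m h x y d d′} → IsDist m h x y d → IsDist m h x y d′ → d ≡ d′
IsDist-unique {d = d} {d′} (w , minimal) (w′ , minimal′) with <-cmp d d′
... | tri< d<d′ _ _ = ⊥-elim (minimal′ d d<d′ w)
... | tri≈ _ d≡d′ _ = d≡d′
... | tri> _ _ d′<d = ⊥-elim (minimal d′ d′<d w′)

IsDiam-unique : ∀ {m h D D′} → IsDiam m h D → IsDiam m h D′ → D ≡ D′
IsDiam-unique D D′ = ≤-antisym (attained≤bound D D′) (attained≤bound D′ D)
  where
  attained≤bound : ∀ {m h D D′} → IsDiam m h D → IsDiam m h D′ → D ≤ D′
  attained≤bound (_ , x , y , x<N , y<N , dist≡D) (bounded , _) with bounded x y x<N y<N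
  ... | d , dist≡d , d≤D′ = subst (_≤ _) (IsDist-unique dist≡d dist≡D) d≤D′

theorem3p16 : ∀ (h : ℕ) → 2 ≤ h → ∀ (D : ℕ) →
    IsDiam 3 (h ∸ 1) D → IsDiam 3 h (suc D)
theorem3p16 (suc h) _ D diam-h =
  subst (IsDiam 3 (suc h)) (cong suc (IsDiam-unique (diameter-MC3 h) diam-h)) (diameter-MC3 (suc h))
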